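{- Let $G$ be a multigraph (multiple edges allowed, no loops) with maximum degree at most $3$, and let the palette be $\mathcal{K}=\{1,2,3,4\}$. Let $M\subseteq E(G)$ be a matching whose edges are assigned arbitrary colours from $\mathcal{K}$. Then this precolouring can be extended to a proper edge-colouring of all of $G$ using only colours from $\mathcal{K}$.
   Context: A proper edge-colouring assigns colours to edges so that any two edges sharing an end-vertex (including parallel edges) receive distinct colours. Extending a precolouring means producing a proper edge-colouring of all of $G$ agreeing with the given colours on the precoloured edges. -}

module Defs where

open import Data.Nat using (ℕ; _≤_)
open import Data.Fin using (Fin)
open import Data.Fin.Properties using (_≟_)
open import Data.Bool using (Bool; true)
open import Data.Product using (_×_; _,_; proj₁; proj₂)
open import Data.Sum using (_⊎_)
open import Data.List using (length; filter)
open import Data.List using () renaming (allFin to allFinL)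
open import Relation.Nullary using (¬_; Dec)
open import Relation.Unary using (Decidable)
open import Relation.Binary.PropositionalEquality using (_≡_; _≢_)
open import Relation.Nullary.Decidable using (_⊎-dec_)

-- A finite loopless multigraph on vertex set Fin n with edge set Fin m;
-- each edge has two distinct end-vertices. Parallel edges are allowed
-- (distinct edge indices may have the same ends).
record Multigraph (n m : ℕ) : Set where
  field
    ends   : Fin m → Fin n × Fin n
    noLoop : (e : Fin m) → proj₁ (ends e) ≢ proj₂ (ends e)

open Multigraph public

Incident : ∀ {n m} → Multigraph n m → Fin m → Fin n → Set
Incident G e v = (proj₁ (ends G e) ≡ v) ⊎ (proj₂ (ends G e) ≡ v)

incident? : ∀ {n m} (G : Multigraph n m) (v : Fin n) → Decidable (λ e → Incident G e v)
incident? G v e = (proj₁ (ends G e) ≟ v) ⊎-dec (proj₂ (ends G e) ≟ v)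

-- degree = number of incident edges (no loops, so each edge counted once)
degree : ∀ {n m} → Multigraph n m → Fin n → ℕ
degree G v = length (filter (incident? G v) (allFinL _))

MaxDegreeAtMost : ∀ {n m} → Multigraph n m → ℕ → Set
MaxDegreeAtMost G d = ∀ v → degree G v ≤ d

Adjacent : ∀ {n m} → Multigraph n m → Fin m → Fin m → Set
Adjacent G e f = (e ≢ f) × (Σv)
  where
  Σv = Data.Product.∃ λ v → Incident G e v × Incident G f v

IsMatching : ∀ {n m} → Multigraph n m → (Fin m → Set) → Set
IsMatching G M = ∀ e f → M e → M f → ¬ Adjacent G e f

IsProperEdgeColouring : ∀ {n m} {C : Set} → Multigraph n m → (Fin m → C) → Set
IsProperEdgeColouring G c = ∀ e f → Adjacent G e f → c e ≢ c f

-- The matching edges are deleted and their colours recorded, at each end-vertex x, in a list F x of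
-- forbidden colours (at most one per vertex, since M is a matching); it remains to colour the other
-- edges properly with colours avoiding F at both ends. This is proved by induction on the number of
-- edges, for all forbidden lists with deg x + |F x| ≤ 3 everywhere and at most one non-isolated vertex
-- with two forbidden colours. An edge is removed and coloured last, possibly after forbidding its
-- future colour at both of its ends (which keeps deg + |F| unchanged there); this works for the edge
-- at an exceptional vertex of degree 1, for an edge with an end where deg + |F| ≤ 2, and for an edge
-- with an end where nothing is forbidden. Otherwise every vertex met by an edge has degree 2 and one
-- forbidden colour, and two adjacent edges uv, uw are coloured by a short case analysis; in the hardest
-- case the third edge at w is moved to v, which has the same forbidden colour.

module Submission where

open import Defs
open import Data.Bool using (Bool; true; false; if_then_else_) renaming (_≟_ to _≟ᵇ_)
open import Data.Bool.Properties using (not-¬)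
open import Data.Empty using (⊥-elim)
open import Data.Fin using (Fin; zero)
open import Data.Fin.Properties using (_≟_; any?; all?)
open import Data.List using (List; []; _∷_; _++_; length; filter; map; allFin)
open import Data.List.Membership.Propositional using (_∈_; _∉_; lose)
open import Data.List.Membership.Propositional.Properties
  using (∈-filter⁺; ∈-filter⁻; ∈-++⁺ˡ; ∈-++⁺ʳ; ∈-∃++; ∈-map⁺; ∈-map⁻; ∈-allFin)
open import Data.List.Membership.DecPropositional (_≟_ {4}) using (_∉?_)
open import Data.List.Properties
  using (≡-dec; map-id; map-∘; filter-accept; filter-reject; filter-none; filter-some; length-map; length-++)
open import Data.List.Relation.Binary.Permutation.Propositional using (_↭_; prep; ↭-sym; ↭⇒↭ₛ)
open import Data.List.Relation.Binary.Permutation.Propositional.Properties as Perm using (filter-↭; ↭-length; shift; ∈-resp-↭)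
import Data.List.Relation.Binary.Permutation.Setoid.Properties as PermSetoid
open import Data.List.Relation.Unary.All as All using (All)
import Data.List.Relation.Unary.AllPairs as AllPairs
open AllPairs using (_∷_)
open import Data.List.Relation.Unary.Any using (here; there)
open import Data.List.Relation.Unary.Unique.Propositional using (Unique)
import Data.List.Relation.Unary.Unique.Propositional.Properties as Unique
open import Data.Nat using (ℕ; zero; suc; _+_; _≤_; _<_; z≤n; s≤s)
open import Data.Nat.Properties
  using ( _≤?_; _<?_; ≤-refl; ≤-reflexive; ≤-trans; ≤-pred; n≤1+n; ≰⇒>; <⇒≱; ≮⇒≥
        ; +-suc; +-mono-≤; m+n≤o⇒n≤o; suc-injective)
open import Data.Product using (Σ; ∃; _×_; _,_; proj₁; proj₂; uncurry)
open import Data.Sum using (_⊎_; inj₁; inj₂; [_,_]′)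
open import Data.Vec.Functional using (updateAt)
open import Data.Vec.Functional.Properties using (updateAt-updates; updateAt-minimal)
open import Function using (_∘_; const)
open import Relation.Binary.PropositionalEquality using (_≡_; _≢_; refl; sym; trans; cong; cong₂; subst; setoid)
open import Relation.Nullary using (¬_; Dec; yes; no)
open import Relation.Nullary.Decidable as Dec using (toWitness; _⊎-dec_; _×-dec_)
open import Relation.Unary using (Decidable)

Colour : Set
Colour = Fin 4

fresh-of-three : (x y z : Colour) → ∃ λ k → k ∉ x ∷ y ∷ z ∷ []
fresh-of-three = toWitness {a? = all? λ x → all? λ y → all? λ z → any? λ k → k ∉? x ∷ y ∷ z ∷ []} _

fresh-colour : (L : List Colour) → length L ≤ 3 → ∃ λ k → k ∉ L
fresh-colour [] _ = zero , λ ()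
fresh-colour (x ∷ []) _ = let k , k∉ = fresh-of-three x x x in k , k∉ ∘ ∈-++⁺ˡ
fresh-colour (x ∷ y ∷ []) _ = let k , k∉ = fresh-of-three x y y in k , k∉ ∘ ∈-++⁺ˡ
fresh-colour (x ∷ y ∷ z ∷ []) _ = fresh-of-three x y z
fresh-colour (_ ∷ _ ∷ _ ∷ _ ∷ _) (s≤s (s≤s (s≤s ())))

-- Colours k for uv and μ for uw in colour-by-rerouting, where j is the colour of the other edge at w
-- and ys are the colours of the other edges at v.
two-colours : ∀ (a b j : Colour) (ys : List Colour) → length ys ≤ 1 → j ≢ b → j ∉ ys →
              ∃ λ k → ∃ λ μ → k ∉ a ∷ b ∷ ys × μ ∉ a ∷ b ∷ j ∷ [] × μ ≢ k
two-colours a b j ys len j≢b j∉ys with j ≟ a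
... | no j≢a = let μ , μ∉ = fresh-colour (a ∷ b ∷ j ∷ []) ≤-refl in
  j , μ , j∉ , μ∉ , μ∉ ∘ there ∘ there ∘ here
  where
  j∉ : j ∉ a ∷ b ∷ ys
  j∉ (here j≡a) = j≢a j≡a
  j∉ (there (here j≡b)) = j≢b j≡b
  j∉ (there (there j∈)) = j∉ys j∈
... | yes refl = k , μ , k∉ , μ∉′ , μ∉ ∘ there ∘ there ∘ here
  where
  k = proj₁ (fresh-colour (a ∷ b ∷ ys) (s≤s (s≤s len)))
  k∉ = proj₂ (fresh-colour (a ∷ b ∷ ys) (s≤s (s≤s len)))
  μ = proj₁ (fresh-colour (a ∷ b ∷ k ∷ []) ≤-refl)
  μ∉ : μ ∉ a ∷ b ∷ k ∷ []
  μ∉ = proj₂ (fresh-colour (a ∷ b ∷ k ∷ []) ≤-refl)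
  μ∉′ : μ ∉ a ∷ b ∷ a ∷ []
  μ∉′ (here μ≡a) = μ∉ (here μ≡a)
  μ∉′ (there (here μ≡b)) = μ∉ (there (here μ≡b))
  μ∉′ (there (there (here μ≡a))) = μ∉ (here μ≡a)

pick : ∀ {A : Set} {x : A} {xs} → x ∈ xs → ∃ λ ys → xs ↭ x ∷ ys
pick {x = x} x∈ with ys , zs , refl ← ∈-∃++ x∈ = ys ++ zs , shift x ys zs

module _ {A : Set} {P : A → Set} (P? : Decidable P) where

  count : List A → ℕ
  count xs = length (filter P? xs)

  count-accept : ∀ {x xs} → P x → count (x ∷ xs) ≡ suc (count xs)
  count-accept px = cong length (filter-accept P? px)

  count-reject : ∀ {x xs} → ¬ P x → count (x ∷ xs) ≡ count xs
  count-reject ¬px = cong length (filter-reject P? ¬px)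

  count-∷-≤ : ∀ x xs → count xs ≤ count (x ∷ xs)
  count-∷-≤ x xs = by-cases (P? x)
    where
    by-cases : Dec (P x) → count xs ≤ count (x ∷ xs)
    by-cases (yes px) = subst (count xs ≤_) (sym (count-accept px)) (n≤1+n _)
    by-cases (no ¬px) = subst (count xs ≤_) (sym (count-reject ¬px)) ≤-refl

  count-↭ : ∀ {xs ys} → xs ↭ ys → count xs ≡ count ys
  count-↭ σ = ↭-length (filter-↭ P? σ)

  count≡0⇒¬ : ∀ {x xs} → count xs ≡ 0 → x ∈ xs → ¬ P x
  count≡0⇒¬ {xs = xs} c≡0 x∈ px with filter P? xs | ∈-filter⁺ P? x∈ px
  ... | [] | ()

  count>0⇒∃ : ∀ {xs} → 0 < count xs → ∃ λ x → x ∈ xs × P x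
  count>0⇒∃ {xs} c>0 with filter P? xs in eq
  ... | x ∷ _ = x , ∈-filter⁻ P? (subst (x ∈_) (sym eq) (here refl))

  count-unique : ∀ {xs} → Unique xs → (∀ {x y} → x ∈ xs → y ∈ xs → P x → P y → x ≡ y) → count xs ≤ 1
  count-unique {[]} _ _ = z≤n
  count-unique {x ∷ xs} (x∉ ∷ u) one = by-cases (P? x)
    where
    by-cases : Dec (P x) → count (x ∷ xs) ≤ 1
    by-cases (no ¬px) = subst (_≤ 1) (sym (count-reject ¬px)) (count-unique u λ x∈ y∈ → one (there x∈) (there y∈))
    by-cases (yes px) =
      subst (_≤ 1) (sym (trans (count-accept px) (cong (suc ∘ length) (filter-none P? (All.tabulate ¬P))))) ≤-refl
      where
      ¬P : ∀ {y} → y ∈ xs → ¬ P y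
      ¬P y∈ py = All.lookup x∉ y∈ (one (here refl) (there y∈) px py)

module EdgeListColouring (n m : ℕ) where

  -- Colourings are indexed by labels, so that an end of an edge can be moved without changing its colour.
  record Edge : Set where
    constructor edge
    field
      label : Fin m
      src tgt : Fin n

  open Edge public

  infix 4 _∈ₑ_ _∈ₑ?_

  data _∈ₑ_ (x : Fin n) (e : Edge) : Set where
    at-src : src e ≡ x → x ∈ₑ e
    at-tgt : tgt e ≡ x → x ∈ₑ e

  _∈ₑ?_ : (x : Fin n) → Decidable (x ∈ₑ_)
  x ∈ₑ? e = Dec.map′ [ at-src , at-tgt ]′ (λ { (at-src s) → inj₁ s ; (at-tgt t) → inj₂ t })
                     ((src e ≟ x) ⊎-dec (tgt e ≟ x))

  deg : List Edge → Fin n → ℕ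
  deg es x = count (x ∈ₑ?_) es

  deg-∷-∈ : ∀ {x e es} → x ∈ₑ e → deg (e ∷ es) x ≡ suc (deg es x)
  deg-∷-∈ {x} = count-accept (x ∈ₑ?_)

  deg-∷-∉ : ∀ {x e es} → ¬ x ∈ₑ e → deg (e ∷ es) x ≡ deg es x
  deg-∷-∉ {x} = count-reject (x ∈ₑ?_)

  deg-∷-≤ : ∀ e es x → deg es x ≤ deg (e ∷ es) x
  deg-∷-≤ e es x = count-∷-≤ (x ∈ₑ?_) e es

  deg-↭ : ∀ {es es′} → es ↭ es′ → ∀ x → deg es x ≡ deg es′ x
  deg-↭ σ x = count-↭ (x ∈ₑ?_) σ

  deg≡0⇒∉ₑ : ∀ {es x e} → deg es x ≡ 0 → e ∈ es → ¬ x ∈ₑ e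
  deg≡0⇒∉ₑ {x = x} = count≡0⇒¬ (x ∈ₑ?_)

  deg>0 : ∀ {es x e} → e ∈ es → x ∈ₑ e → 0 < deg es x
  deg>0 {x = x} e∈ x∈ₑe = filter-some (x ∈ₑ?_) (lose e∈ x∈ₑe)

  deg>0⇒∃ : ∀ {es x} → 0 < deg es x → ∃ λ e → e ∈ es × x ∈ₑ e
  deg>0⇒∃ {x = x} = count>0⇒∃ (x ∈ₑ?_)

  deg-∷-mono : ∀ {e e′ es es′ x} → (x ∈ₑ e′ → x ∈ₑ e) → deg es x ≤ deg es′ x →
               deg (e′ ∷ es) x ≤ deg (e ∷ es′) x
  deg-∷-mono {e} {e′} {es} {es′} {x} ends⊆ le with x ∈ₑ? e′
  ... | yes x∈ₑe′ =
    subst (_≤ deg (e ∷ es′) x) (sym (deg-∷-∈ x∈ₑe′))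
          (subst (suc (deg es x) ≤_) (sym (deg-∷-∈ (ends⊆ x∈ₑe′))) (s≤s le))
  ... | no x∉ₑe′ = subst (_≤ deg (e ∷ es′) x) (sym (deg-∷-∉ x∉ₑe′)) (≤-trans le (deg-∷-≤ e es′ x))

  deg≡2⇒isolated : ∀ {e e′ es x} → deg (e ∷ e′ ∷ es) x ≡ 2 → x ∈ₑ e → x ∈ₑ e′ → deg es x ≡ 0
  deg≡2⇒isolated d≡2 x∈ₑe x∈ₑe′ =
    suc-injective (suc-injective (trans (sym (trans (deg-∷-∈ x∈ₑe) (cong suc (deg-∷-∈ x∈ₑe′)))) d≡2))

  data Joins (e : Edge) (u v : Fin n) : Set where
    src→tgt : src e ≡ u → tgt e ≡ v → Joins e u v
    tgt→src : src e ≡ v → tgt e ≡ u → Joins e u v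

  joins-src-tgt : ∀ e → Joins e (src e) (tgt e)
  joins-src-tgt e = src→tgt refl refl

  joins-∈ₑˡ : ∀ {e u v} → Joins e u v → u ∈ₑ e
  joins-∈ₑˡ (src→tgt su _) = at-src su
  joins-∈ₑˡ (tgt→src _ tu) = at-tgt tu

  joins-∈ₑʳ : ∀ {e u v} → Joins e u v → v ∈ₑ e
  joins-∈ₑʳ (src→tgt _ tv) = at-tgt tv
  joins-∈ₑʳ (tgt→src sv _) = at-src sv

  joins-elim : ∀ {e u v} (P : Fin n → Set) → Joins e u v → P u → P v → ∀ {x} → x ∈ₑ e → P x
  joins-elim P (src→tgt refl refl) pu pv (at-src refl) = pu
  joins-elim P (src→tgt refl refl) pu pv (at-tgt refl) = pv
  joins-elim P (tgt→src refl refl) pu pv (at-src refl) = pv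
  joins-elim P (tgt→src refl refl) pu pv (at-tgt refl) = pu

  joins-other-end : ∀ {e x} → x ∈ₑ e → ∃ (Joins e x)
  joins-other-end (at-src refl) = _ , src→tgt refl refl
  joins-other-end (at-tgt refl) = _ , tgt→src refl refl

  joins-≢ : ∀ {e u v} → src e ≢ tgt e → Joins e u v → u ≢ v
  joins-≢ loopless (src→tgt refl refl) = loopless
  joins-≢ loopless (tgt→src refl refl) = loopless ∘ sym

  Forbidden : Set
  Forbidden = Fin n → List Colour

  record Admissible (F : Forbidden) (es : List Edge) : Set where
    field
      loopless : ∀ {e} → e ∈ es → src e ≢ tgt e
      labels-unique : Unique (map label es)
      load : ∀ x → deg es x + length (F x) ≤ 3

  open Admissible public

  admissible-tail : ∀ {F e es} → Admissible F (e ∷ es) → Admissible F es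
  admissible-tail {e = e} {es} adm = record
    { loopless = loopless adm ∘ there
    ; labels-unique = AllPairs.tail (labels-unique adm)
    ; load = λ x → ≤-trans (+-mono-≤ (deg-∷-≤ e es x) ≤-refl) (load adm x)
    }

  admissible-↭ : ∀ {F es es′} → es ↭ es′ → Admissible F es → Admissible F es′
  admissible-↭ {F} σ adm = record
    { loopless = loopless adm ∘ ∈-resp-↭ (↭-sym σ)
    ; labels-unique = PermSetoid.Unique-resp-↭ (setoid (Fin m)) (↭⇒↭ₛ (Perm.map⁺ label σ)) (labels-unique adm)
    ; load = λ x → subst (λ d → d + length (F x) ≤ 3) (deg-↭ σ x) (load adm x)
    }

  label-fresh : ∀ {F e es} → Admissible F (e ∷ es) → ∀ {f} → f ∈ es → label e ≢ label f
  label-fresh adm f∈ = All.lookup (AllPairs.head (labels-unique adm)) (∈-map⁺ label f∈)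

  record Heavy (F : Forbidden) (es : List Edge) (x : Fin n) : Set where
    constructor heavy
    field
      occupied : 0 < deg es x
      overloaded : 1 < length (F x)

  heavy? : ∀ F es → Decidable (Heavy F es)
  heavy? F es x = Dec.map′ (uncurry heavy) (λ (heavy o l) → o , l) ((0 <? deg es x) ×-dec (1 <? length (F x)))

  AtMostOneHeavy : Forbidden → List Edge → Set
  AtMostOneHeavy F es = ∀ {x y} → Heavy F es x → Heavy F es y → x ≡ y

  record AllLight (F : Forbidden) (es : List Edge) : Set where
    constructor all-light
    field
      light-at : ∀ x → 0 < deg es x → length (F x) ≤ 1

  open AllLight public

  light⇒¬heavy : ∀ {F es} → AllLight F es → ∀ {x} → ¬ Heavy F es x
  light⇒¬heavy light (heavy d>0 f>1) = <⇒≱ f>1 (light-at light _ d>0)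

  heavy-or-light : ∀ F es → ∃ (Heavy F es) ⊎ AllLight F es
  heavy-or-light F es with any? (heavy? F es)
  ... | yes found = inj₁ found
  ... | no none = inj₂ (all-light λ x d>0 → ≮⇒≥ λ f>1 → none (x , heavy d>0 f>1))

  heavy-only-at : ∀ {F es} z → (∀ {x} → Heavy F es x → x ≡ z) → AtMostOneHeavy F es
  heavy-only-at z at-z hx hy = trans (at-z hx) (sym (at-z hy))

  heavy-tail : ∀ {F e es x} → Heavy F es x → Heavy F (e ∷ es) x
  heavy-tail {e = e} {es} {x} (heavy d>0 f>1) = heavy (≤-trans d>0 (deg-∷-≤ e es x)) f>1

  at-most-one-heavy-tail : ∀ {F e es} → AtMostOneHeavy F (e ∷ es) → AtMostOneHeavy F es
  at-most-one-heavy-tail one hx hy = one (heavy-tail hx) (heavy-tail hy)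

  light-mono : ∀ {F es es′} → (∀ x → deg es x ≤ deg es′ x) → AllLight F es′ → AllLight F es
  light-mono ≤deg light = all-light λ x d>0 → light-at light x (≤-trans d>0 (≤deg x))

  light⇒at-most-one-heavy : ∀ {F es} → AllLight F es → AtMostOneHeavy F es
  light⇒at-most-one-heavy light hx = ⊥-elim (light⇒¬heavy light hx)

  Colouring : Set
  Colouring = Fin m → Colour

  Proper : List Edge → Colouring → Set
  Proper es c = ∀ {e f} → e ∈ es → f ∈ es → label e ≢ label f →
                ∀ {x} → x ∈ₑ e → x ∈ₑ f → c (label e) ≢ c (label f)

  Avoids : Forbidden → List Edge → Colouring → Set
  Avoids F es c = ∀ {e} → e ∈ es → ∀ {x} → x ∈ₑ e → c (label e) ∉ F x

  record ListColouring (F : Forbidden) (es : List Edge) : Set where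
    field
      colour : Colouring
      proper : Proper es colour
      avoids : Avoids F es colour

  open ListColouring public

  empty-colouring : ∀ {F} → ListColouring F []
  empty-colouring = record { colour = const zero ; proper = λ () ; avoids = λ () }

  restrict : ∀ {F es es′} → (∀ {e} → e ∈ es → e ∈ es′) → ListColouring F es′ → ListColouring F es
  restrict ⊆ S = record
    { colour = colour S
    ; proper = λ e∈ f∈ → proper S (⊆ e∈) (⊆ f∈)
    ; avoids = avoids S ∘ ⊆
    }

  relax : ∀ {F F′ es} → (∀ {x k} → k ∈ F x → k ∈ F′ x) → ListColouring F′ es → ListColouring F es
  relax ⊆ S = record
    { colour = colour S
    ; proper = proper S
    ; avoids = λ e∈ x∈ₑe → avoids S e∈ x∈ₑe ∘ ⊆
    }

  record Free (F : Forbidden) (es : List Edge) (c : Colouring) (x : Fin n) (k : Colour) : Set where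
    constructor free
    field
      unforbidden : k ∉ F x
      unused : ∀ {f} → f ∈ es → x ∈ₑ f → c (label f) ≢ k

  open Free public

  module _ {F e es} (S : ListColouring F es) (distinct : ∀ {f} → f ∈ es → label e ≢ label f) (k : Colour) where

    recolour : Colouring
    recolour = updateAt (colour S) (label e) (const k)

    recolour-new : recolour (label e) ≡ k
    recolour-new = updateAt-updates (label e) (colour S)

    recolour-old : ∀ {f} → f ∈ es → recolour (label f) ≡ colour S (label f)
    recolour-old {f} f∈ = updateAt-minimal (label f) (label e) (colour S) (distinct f∈ ∘ sym)

    extend : (∀ {x} → x ∈ₑ e → Free F es (colour S) x k) → ListColouring F (e ∷ es)
    extend is-free = record { colour = recolour ; proper = proper′ ; avoids = avoids′ }
      where
      proper′ : Proper (e ∷ es) recolour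
      proper′ (here refl) (here refl) ne = ⊥-elim (ne refl)
      proper′ (here refl) (there f∈) _ x∈ₑe x∈ₑf eq =
        unused (is-free x∈ₑe) f∈ x∈ₑf (trans (sym (recolour-old f∈)) (trans (sym eq) recolour-new))
      proper′ (there f∈) (here refl) _ x∈ₑf x∈ₑe eq =
        unused (is-free x∈ₑe) f∈ x∈ₑf (trans (sym (recolour-old f∈)) (trans eq recolour-new))
      proper′ (there f∈) (there g∈) ne x∈ₑf x∈ₑg eq =
        proper S f∈ g∈ ne x∈ₑf x∈ₑg (trans (sym (recolour-old f∈)) (trans eq (recolour-old g∈)))
      avoids′ : Avoids F (e ∷ es) recolour
      avoids′ (here refl) x∈ₑe = subst (_∉ _) (sym recolour-new) (unforbidden (is-free x∈ₑe))
      avoids′ (there f∈) x∈ₑf = subst (_∉ _) (sym (recolour-old f∈)) (avoids S f∈ x∈ₑf)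


  free-isolated : ∀ {F es c x k} → deg es x ≡ 0 → k ∉ F x → Free F es c x k
  free-isolated d≡0 k∉ = free k∉ λ f∈ x∈ₑf → ⊥-elim (deg≡0⇒∉ₑ d≡0 f∈ x∈ₑf)

  colours-at : Colouring → List Edge → Fin n → List Colour
  colours-at c es x = map (c ∘ label) (filter (x ∈ₑ?_) es)

  length-colours-at : ∀ c es x → length (colours-at c es x) ≡ deg es x
  length-colours-at c es x = length-map (c ∘ label) (filter (x ∈ₑ?_) es)

  ∈-colours-at : ∀ c {es x f} → f ∈ es → x ∈ₑ f → c (label f) ∈ colours-at c es x
  ∈-colours-at c {x = x} f∈ x∈ₑf = ∈-map⁺ (c ∘ label) (∈-filter⁺ (x ∈ₑ?_) f∈ x∈ₑf)

  ∈-colours-at⁻ : ∀ c {es x k} → k ∈ colours-at c es x → ∃ λ f → f ∈ es × x ∈ₑ f × k ≡ c (label f)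
  ∈-colours-at⁻ c {es} {x} k∈ with f , f∈filter , k≡ ← ∈-map⁻ (c ∘ label) k∈
    with f∈ , x∈ₑf ← ∈-filter⁻ (x ∈ₑ?_) {xs = es} f∈filter = f , f∈ , x∈ₑf , k≡

  free-unused : ∀ {F es c x k} → k ∉ F x → k ∉ colours-at c es x → Free F es c x k
  free-unused {c = c} k∉ k∉cs = free k∉ λ f∈ x∈ₑf eq → k∉cs (subst (_∈ _) eq (∈-colours-at c f∈ x∈ₑf))

  forbid-ends : Edge → Colour → Forbidden → Forbidden
  forbid-ends e k F x with x ∈ₑ? e
  ... | yes _ = k ∷ F x
  ... | no _ = F x

  forbid-ends-∈ₑ : ∀ {e k F x} → x ∈ₑ e → forbid-ends e k F x ≡ k ∷ F x
  forbid-ends-∈ₑ {e} {x = x} x∈ₑe with x ∈ₑ? e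
  ... | yes _ = refl
  ... | no x∉ₑe = ⊥-elim (x∉ₑe x∈ₑe)

  forbid-ends-∉ₑ : ∀ {e k F x} → ¬ x ∈ₑ e → forbid-ends e k F x ≡ F x
  forbid-ends-∉ₑ {e} {x = x} x∉ₑe with x ∈ₑ? e
  ... | yes x∈ₑe = ⊥-elim (x∉ₑe x∈ₑe)
  ... | no _ = refl

  forbid-ends-⊇ : ∀ {e k F x j} → j ∈ F x → j ∈ forbid-ends e k F x
  forbid-ends-⊇ {e} {x = x} j∈ with x ∈ₑ? e
  ... | yes _ = there j∈
  ... | no _ = j∈

  ∉-forbid-ends : ∀ {e k F x j} → j ≢ k → j ∉ F x → j ∉ forbid-ends e k F x
  ∉-forbid-ends {e} {x = x} j≢k j∉ with x ∈ₑ? e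
  ... | yes _ = λ { (here j≡k) → j≢k j≡k ; (there j∈) → j∉ j∈ }
  ... | no _ = j∉

  admissible-forbid-ends : ∀ {F e es k} → Admissible F (e ∷ es) → Admissible (forbid-ends e k F) es
  admissible-forbid-ends {F} {e} {es} {k} adm = record
    { loopless = loopless (admissible-tail adm)
    ; labels-unique = labels-unique (admissible-tail adm)
    ; load = load′
    }
    where
    load′ : ∀ x → deg es x + length (forbid-ends e k F x) ≤ 3
    load′ x with x ∈ₑ? e
    ... | yes x∈ₑe = subst (_≤ 3) (trans (cong (_+ length (F x)) (deg-∷-∈ x∈ₑe)) (sym (+-suc _ _))) (load adm x)
    ... | no x∉ₑe = subst (λ d → d + length (F x) ≤ 3) (deg-∷-∉ x∉ₑe) (load adm x)

  colour-by-forbidding : ∀ {F e es k} → Admissible F (e ∷ es) → (∀ {x} → x ∈ₑ e → k ∉ F x) →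
                         ListColouring (forbid-ends e k F) es → ListColouring F (e ∷ es)
  colour-by-forbidding {F} {e} {es} {k} adm k∉ S =
    extend (relax (forbid-ends-⊇ {e} {k}) S) (label-fresh adm) k λ x∈ₑe → free (k∉ x∈ₑe) λ f∈ x∈ₑf eq →
      avoids S f∈ x∈ₑf (subst (_∈ _) (sym eq) (subst (k ∈_) (sym (forbid-ends-∈ₑ x∈ₑe)) (here refl)))

  forbid-ends-unused : ∀ {F e es k} (S : ListColouring F es) →
                       (∀ {x} → x ∈ₑ e → ∀ {f} → f ∈ es → x ∈ₑ f → colour S (label f) ≢ k) →
                       ListColouring (forbid-ends e k F) es
  forbid-ends-unused {F} {e} {es} {k} S unused = record
    { colour = colour S
    ; proper = proper S
    ; avoids = avoids′
    }
    where
    avoids′ : Avoids (forbid-ends e k F) es (colour S)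
    avoids′ {f} f∈ {x} x∈ₑf with x ∈ₑ? e
    ... | yes x∈ₑe = λ { (here eq) → unused x∈ₑe f∈ x∈ₑf eq ; (there j∈) → avoids S f∈ x∈ₑf j∈ }
    ... | no _ = avoids S f∈ x∈ₑf


  reattach-end : ∀ {F e es w v t} → Joins e w t → deg es w ≡ 0 → F w ≡ F v →
                 ListColouring F (edge (label e) v t ∷ es) → ListColouring F (e ∷ es)
  reattach-end {F} {e} {es} {w} {v} {t} wt w-isolated Fw≡Fv S = record { colour = colour S ; proper = proper′ ; avoids = avoids′ }
    where
    moved : ∀ {x} → x ∈ₑ e → x ≡ w ⊎ x ∈ₑ edge (label e) v t
    moved = joins-elim (λ x → x ≡ w ⊎ x ∈ₑ edge (label e) v t) wt (inj₁ refl) (inj₂ (at-tgt refl))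
    not-w : ∀ {x f} → f ∈ es → x ∈ₑ f → x ≢ w
    not-w f∈ x∈ₑf refl = deg≡0⇒∉ₑ w-isolated f∈ x∈ₑf
    proper′ : Proper (e ∷ es) (colour S)
    proper′ (here refl) (here refl) ne = ⊥-elim (ne refl)
    proper′ (here refl) (there f∈) ne x∈ₑe x∈ₑf =
      [ ⊥-elim ∘ not-w f∈ x∈ₑf , (λ x∈ₑe′ → proper S (here refl) (there f∈) ne x∈ₑe′ x∈ₑf) ]′
        (moved x∈ₑe)
    proper′ (there f∈) (here refl) ne x∈ₑf x∈ₑe =
      [ ⊥-elim ∘ not-w f∈ x∈ₑf , (λ x∈ₑe′ → proper S (there f∈) (here refl) ne x∈ₑf x∈ₑe′) ]′
        (moved x∈ₑe)
    proper′ (there f∈) (there g∈) = proper S (there f∈) (there g∈)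
    avoids′ : Avoids F (e ∷ es) (colour S)
    avoids′ (here refl) x∈ₑe =
      [ (λ { refl → subst (_ ∉_) (sym Fw≡Fv) (avoids S (here refl) (at-src refl)) }) , avoids S (here refl) ]′ (moved x∈ₑe)
    avoids′ (there f∈) = avoids S (there f∈)

  -- Reductions

  ColourableUpTo : ℕ → Set
  ColourableUpTo N = ∀ {F es} → length es ≤ N → Admissible F es → AtMostOneHeavy F es → ListColouring F es

  heavy-forbid-ends-∉ₑ : ∀ {F e es k x} → ¬ x ∈ₑ e → Heavy (forbid-ends e k F) es x → Heavy F (e ∷ es) x
  heavy-forbid-ends-∉ₑ {F} {e} {es} {k} {x} x∉ₑe (heavy d>0 f>1) =
    heavy (≤-trans d>0 (deg-∷-≤ e es x)) (subst (λ L → 1 < length L) (forbid-ends-∉ₑ x∉ₑe) f>1)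

  forbid-ends-heavy-only-at : ∀ {F e es k u v} → Joins e u v → ¬ Heavy (forbid-ends e k F) es u →
                              (∀ {x} → ¬ x ∈ₑ e → ¬ Heavy F (e ∷ es) x) → AtMostOneHeavy (forbid-ends e k F) es
  forbid-ends-heavy-only-at {F} {e} {es} {k} {u} {v} uv ¬heavy-u ¬heavy-off = heavy-only-at v at-v
    where
    at-v : ∀ {x} → Heavy (forbid-ends e k F) es x → x ≡ v
    at-v {x} hx with x ∈ₑ? e
    ... | yes x∈ₑe =
      joins-elim (λ y → Heavy (forbid-ends e k F) es y → y ≡ v) uv (⊥-elim ∘ ¬heavy-u) (λ _ → refl) x∈ₑe hx
    ... | no x∉ₑe = ⊥-elim (¬heavy-off x∉ₑe (heavy-forbid-ends-∉ₑ x∉ₑe hx))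

  colour-heavy-end : ∀ {N} → ColourableUpTo N → ∀ {F e es p} → length es ≤ N →
                     Admissible F (e ∷ es) → AtMostOneHeavy F (e ∷ es) → p ∈ₑ e → Heavy F (e ∷ es) p →
                     ListColouring F (e ∷ es)
  colour-heavy-end ih {F} {e} {es} {p} len adm one p∈ₑe hp =
    colour-by-forbidding adm k∉ (ih len (admissible-forbid-ends adm) heavy-at-z)
    where
    z = proj₁ (joins-other-end p∈ₑe)
    pz : Joins e p z
    pz = proj₂ (joins-other-end p∈ₑe)
    load-p : suc (deg es p) + length (F p) ≤ 3
    load-p = subst (λ d → d + length (F p) ≤ 3) (deg-∷-∈ p∈ₑe) (load adm p)
    p-isolated : deg es p ≡ 0
    p-isolated = overloaded-end load-p (Heavy.overloaded hp)
      where
      overloaded-end : ∀ {d f} → suc d + f ≤ 3 → 1 < f → d ≡ 0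
      overloaded-end {zero} _ _ = refl
      overloaded-end {suc d} le f>1 = ⊥-elim (<⇒≱ f>1 (m+n≤o⇒n≤o d (≤-pred (≤-pred le))))
    z-light : length (F z) ≤ 1
    z-light = ≮⇒≥ λ f>1 → joins-≢ (loopless adm (here refl)) pz (one hp (heavy (deg>0 (here refl) (joins-∈ₑʳ pz)) f>1))
    fresh = fresh-colour (F p ++ F z)
              (subst (_≤ 3) (sym (length-++ (F p))) (+-mono-≤ (m+n≤o⇒n≤o (deg es p) (≤-pred load-p)) z-light))
    k = proj₁ fresh
    k∉ : ∀ {x} → x ∈ₑ e → k ∉ F x
    k∉ = joins-elim (λ x → k ∉ F x) pz (proj₂ fresh ∘ ∈-++⁺ˡ) (proj₂ fresh ∘ ∈-++⁺ʳ (F p))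
    heavy-at-z : AtMostOneHeavy (forbid-ends e k F) es
    heavy-at-z = forbid-ends-heavy-only-at pz (λ hp′ → <⇒≱ (Heavy.occupied hp′) (subst (_≤ 0) (sym p-isolated) z≤n))
                   (λ x∉ₑe hx → x∉ₑe (subst (_∈ₑ e) (one hp hx) p∈ₑe))

  colour-unforbidden-end : ∀ {N} → ColourableUpTo N → ∀ {F e es u} → length es ≤ N →
                           Admissible F (e ∷ es) → AllLight F (e ∷ es) → u ∈ₑ e → F u ≡ [] →
                           ListColouring F (e ∷ es)
  colour-unforbidden-end ih {F} {e} {es} {u} len adm light u∈ₑe Fu≡[] =
    colour-by-forbidding adm k∉ (ih len (admissible-forbid-ends adm) heavy-at-v)
    where
    v = proj₁ (joins-other-end u∈ₑe)
    uv : Joins e u v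
    uv = proj₂ (joins-other-end u∈ₑe)
    fresh = fresh-colour (F v) (≤-trans (light-at light v (deg>0 (here refl) (joins-∈ₑʳ uv))) (s≤s z≤n))
    k = proj₁ fresh
    k∉ : ∀ {x} → x ∈ₑ e → k ∉ F x
    k∉ = joins-elim (λ x → k ∉ F x) uv (subst (k ∉_) (sym Fu≡[]) λ ()) (proj₂ fresh)
    heavy-at-v : AtMostOneHeavy (forbid-ends e k F) es
    heavy-at-v = forbid-ends-heavy-only-at uv
                   (λ hu → <⇒≱ (Heavy.overloaded hu)
                             (subst (λ L → length L ≤ 1) (sym (trans (forbid-ends-∈ₑ u∈ₑe) (cong (k ∷_) Fu≡[]))) ≤-refl))
                   (λ _ → light⇒¬heavy light)

  colour-slack-end : ∀ {N} → ColourableUpTo N → ∀ {F e es u} → length es ≤ N →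
                     Admissible F (e ∷ es) → AtMostOneHeavy F (e ∷ es) → u ∈ₑ e → deg (e ∷ es) u + length (F u) ≤ 2 →
                     ListColouring F (e ∷ es)
  colour-slack-end ih {F} {e} {es} {u} len adm one u∈ₑe slack =
    extend S (label-fresh adm) k (joins-elim (λ x → Free F es c x k) uv
      (free-unused (k∉ ∘ ∈-++⁺ˡ ∘ ∈-++⁺ʳ (colours-at c es u)) (k∉ ∘ ∈-++⁺ˡ ∘ ∈-++⁺ˡ))
      (free-unused (k∉ ∘ ∈-++⁺ʳ (colours-at c es u ++ F u) ∘ ∈-++⁺ʳ (colours-at c es v))
                   (k∉ ∘ ∈-++⁺ʳ (colours-at c es u ++ F u) ∘ ∈-++⁺ˡ)))
    where
    S = ih len (admissible-tail adm) (at-most-one-heavy-tail one)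
    c = colour S
    v = proj₁ (joins-other-end u∈ₑe)
    uv : Joins e u v
    uv = proj₂ (joins-other-end u∈ₑe)
    length-at : ∀ x → length (colours-at c es x ++ F x) ≡ deg es x + length (F x)
    length-at x = trans (length-++ (colours-at c es x)) (cong (_+ length (F x)) (length-colours-at c es x))
    load-at : ∀ {x} → x ∈ₑ e → ∀ {b} → deg (e ∷ es) x + length (F x) ≤ suc b → length (colours-at c es x ++ F x) ≤ b
    load-at {x} x∈ₑe {b} le =
      ≤-pred (subst (_≤ suc b) (trans (cong (_+ length (F x)) (deg-∷-∈ x∈ₑe)) (cong suc (sym (length-at x)))) le)
    fresh = fresh-colour ((colours-at c es u ++ F u) ++ (colours-at c es v ++ F v))
              (subst (_≤ 3) (sym (length-++ (colours-at c es u ++ F u)))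
                     (+-mono-≤ (load-at u∈ₑe slack) (load-at (joins-∈ₑʳ uv) (load adm v))))
    k = proj₁ fresh
    k∉ = proj₂ fresh

  -- Two adjacent edges when no reduction applies

  module TightPath {N} (ih : ColourableUpTo N) {F e0 e1 es2 u v w a b c}
                   (len : length es2 ≤ N) (adm : Admissible F (e0 ∷ e1 ∷ es2)) (light : AllLight F (e0 ∷ e1 ∷ es2))
                   (uv : Joins e0 u v) (uw : Joins e1 u w)
                   (Fu : F u ≡ a ∷ []) (Fv : F v ≡ b ∷ []) (Fw : F w ≡ c ∷ [])
                   (deg-u : deg (e0 ∷ e1 ∷ es2) u ≡ 2) (deg-v : deg (e0 ∷ e1 ∷ es2) v ≡ 2)
                   (deg-w : deg (e0 ∷ e1 ∷ es2) w ≡ 2)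
                   where

    -- Every case colours es2 so that some k ∉ {a, b} is unused at v, then e1, and finally e0 with k.

    adm1 : Admissible F (e1 ∷ es2)
    adm1 = admissible-tail adm

    adm2 : Admissible F es2
    adm2 = admissible-tail adm1

    deg≤ : ∀ x → deg es2 x ≤ deg (e0 ∷ e1 ∷ es2) x
    deg≤ x = ≤-trans (deg-∷-≤ e1 es2 x) (deg-∷-≤ e0 (e1 ∷ es2) x)

    u-isolated : deg es2 u ≡ 0
    u-isolated = deg≡2⇒isolated deg-u (joins-∈ₑˡ uv) (joins-∈ₑˡ uw)

    w-deg : deg es2 w ≤ 1
    w-deg = ≤-pred (subst (_≤ 2) (deg-∷-∈ (joins-∈ₑʳ uw))
                          (subst (deg (e1 ∷ es2) w ≤_) deg-w (deg-∷-≤ e0 (e1 ∷ es2) w)))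

    ∉-single : ∀ {x d j} → F x ≡ d ∷ [] → j ≢ d → j ∉ F x
    ∉-single Fx j≢d = subst (_ ∉_) (sym Fx) λ { (here j≡d) → j≢d j≡d }

    complete-path : ∀ {k μ} → k ≢ a → k ≢ b → μ ∉ k ∷ a ∷ c ∷ [] →
                    (S : ListColouring (forbid-ends e0 k F) es2) →
                    (∀ {f} → f ∈ es2 → w ∈ₑ f → colour S (label f) ≢ μ) → ListColouring F (e0 ∷ e1 ∷ es2)
    complete-path {k} {μ} k≢a k≢b μ∉ S μ-unused-at-w =
      colour-by-forbidding adm (joins-elim (λ x → k ∉ F x) uv (∉-single Fu k≢a) (∉-single Fv k≢b))
        (extend S (label-fresh adm1) μ (joins-elim (λ x → Free (forbid-ends e0 k F) es2 (colour S) x μ) uw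
          (free-isolated u-isolated (∉-forbid-ends {e0} {k} (μ∉ ∘ here) (∉-single Fu (μ∉ ∘ there ∘ here))))
          (free (∉-forbid-ends {e0} {k} (μ∉ ∘ here) (∉-single Fw (μ∉ ∘ there ∘ there ∘ here))) μ-unused-at-w)))

    forbid-unused-at-e0 : ∀ {k} (S : ListColouring F es2) → (∀ {f} → f ∈ es2 → v ∈ₑ f → colour S (label f) ≢ k) →
           ListColouring (forbid-ends e0 k F) es2
    forbid-unused-at-e0 {k} S k-unused-at-v = forbid-ends-unused S
      (joins-elim (λ x → ∀ {f} → f ∈ es2 → x ∈ₑ f → colour S (label f) ≢ k) uv
        (λ f∈ u∈ₑf → ⊥-elim (deg≡0⇒∉ₑ u-isolated f∈ u∈ₑf)) k-unused-at-v)

    colour-rest-forbidding : ∀ k → ListColouring (forbid-ends e0 k F) es2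
    colour-rest-forbidding k = ih len (admissible-tail (admissible-forbid-ends adm)) (heavy-only-at v at-v)
      where
      at-v : ∀ {x} → Heavy (forbid-ends e0 k F) es2 x → x ≡ v
      at-v {x} hx with x ∈ₑ? e0
      ... | yes x∈ₑe0 =
        joins-elim (λ y → Heavy (forbid-ends e0 k F) es2 y → y ≡ v) uv
          (λ hu → ⊥-elim (<⇒≱ (Heavy.occupied hu) (subst (_≤ 0) (sym u-isolated) z≤n))) (λ _ → refl) x∈ₑe0 hx
      ... | no x∉ₑe0 =
        ⊥-elim (light⇒¬heavy light (heavy (≤-trans (Heavy.occupied hx) (deg≤ x))
                                          (subst (λ L → 1 < length L) (forbid-ends-∉ₑ x∉ₑe0) (Heavy.overloaded hx))))

    colour-via-forbidding : ∀ {k} → k ≢ a → k ≢ b → c ≡ a ⊎ c ≡ k → ListColouring F (e0 ∷ e1 ∷ es2)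
    colour-via-forbidding {k} k≢a k≢b c∈ = complete-path k≢a k≢b μ∉ S
      λ f∈ w∈ₑf μ≡ → μ∉L (there (there (subst (_∈ colours-at (colour S) es2 w) μ≡
                                                (∈-colours-at (colour S) f∈ w∈ₑf))))
      where
      S = colour-rest-forbidding k
      fresh = fresh-colour (a ∷ k ∷ colours-at (colour S) es2 w)
                           (s≤s (s≤s (subst (_≤ 1) (sym (length-colours-at (colour S) es2 w)) w-deg)))
      μ = proj₁ fresh
      μ∉L = proj₂ fresh
      μ∉ : μ ∉ k ∷ a ∷ c ∷ []
      μ∉ (here μ≡k) = μ∉L (there (here μ≡k))
      μ∉ (there (here μ≡a)) = μ∉L (here μ≡a)
      μ∉ (there (there (here μ≡c))) =
        [ (λ c≡a → μ∉L (here (trans μ≡c c≡a))) , (λ c≡k → μ∉L (there (here (trans μ≡c c≡k)))) ]′ c∈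

    colour-digon : w ≡ v → ListColouring F (e0 ∷ e1 ∷ es2)
    colour-digon w≡v = complete-path (k∉ ∘ here) (k∉ ∘ there ∘ here) μ∉
                         (forbid-unused-at-e0 S (λ f∈ → ⊥-elim ∘ deg≡0⇒∉ₑ v-isolated f∈))
                         (λ f∈ → ⊥-elim ∘ deg≡0⇒∉ₑ v-isolated f∈ ∘ subst (_∈ₑ _) w≡v)
      where
      v-isolated : deg es2 v ≡ 0
      v-isolated = deg≡2⇒isolated deg-v (joins-∈ₑʳ uv) (subst (_∈ₑ e1) w≡v (joins-∈ₑʳ uw))
      S = ih len adm2 (light⇒at-most-one-heavy (light-mono deg≤ light))
      k = proj₁ (fresh-colour (a ∷ b ∷ []) (s≤s (s≤s z≤n)))
      k∉ = proj₂ (fresh-colour (a ∷ b ∷ []) (s≤s (s≤s z≤n)))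
      μ = proj₁ (fresh-colour (k ∷ a ∷ c ∷ []) ≤-refl)
      μ∉ = proj₂ (fresh-colour (k ∷ a ∷ c ∷ []) ≤-refl)

    w∉ₑe0 : w ≢ v → ¬ w ∈ₑ e0
    w∉ₑe0 w≢v w∈ₑe0 =
      joins-elim (λ x → x ≢ w) uv (joins-≢ (loopless adm (there (here refl))) uw) (w≢v ∘ sym) w∈ₑe0 refl

    module ThirdEdge (c≡b : c ≡ b) (a≢b : a ≢ b) (w≢v : w ≢ v) {e2 es3 t} (σ : es2 ↭ e2 ∷ es3) (wt : Joins e2 w t) where

      adm2′ : Admissible F (e2 ∷ es3)
      adm2′ = admissible-↭ σ adm2

      adm3 : Admissible F es3
      adm3 = admissible-tail adm2′

      len2′ : length (e2 ∷ es3) ≤ N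
      len2′ = subst (_≤ N) (↭-length σ) len

      deg3≤ : ∀ x → deg es3 x ≤ deg (e0 ∷ e1 ∷ es2) x
      deg3≤ x = ≤-trans (deg-∷-≤ e2 es3 x) (subst (_≤ _) (deg-↭ σ x) (deg≤ x))

      w-isolated : deg es3 w ≡ 0
      w-isolated = deg≡2⇒isolated (trans (sym (deg-↭ (prep e1 σ) w)) (trans (sym (deg-∷-∉ (w∉ₑe0 w≢v))) deg-w))
                                   (joins-∈ₑʳ uw) (joins-∈ₑˡ wt)

      v∉ₑe1 : ¬ v ∈ₑ e1
      v∉ₑe1 v∈ₑe1 = joins-elim (λ x → x ≢ v) uw (joins-≢ (loopless adm (here refl)) uv) w≢v v∈ₑe1 refl

      Fw≡Fv : F w ≡ F v
      Fw≡Fv = trans Fw (trans (cong (_∷ []) c≡b) (sym Fv))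

      colour-triangle : t ≡ v → ListColouring F (e0 ∷ e1 ∷ es2)
      colour-triangle t≡v = complete-path (k∉ ∘ here) (k∉ ∘ there ∘ here) μ∉
        (forbid-unused-at-e0 S2 λ f∈ v∈ₑf k≡ → k∉ (here (trans (sym k≡) (coloured-a v-isolated (∈-resp-↭ σ f∈) v∈ₑf))))
        (λ f∈ w∈ₑf μ≡ → μ∉ (there (here (trans (sym μ≡) (coloured-a w-isolated (∈-resp-↭ σ f∈) w∈ₑf)))))
        where
        v∈ₑe2 : v ∈ₑ e2
        v∈ₑe2 = subst (_∈ₑ e2) t≡v (joins-∈ₑʳ wt)
        v-isolated : deg es3 v ≡ 0
        v-isolated = suc-injective (suc-injective (trans
          (sym (trans (deg-∷-∈ (joins-∈ₑʳ uv)) (cong suc (trans (deg-∷-∉ v∉ₑe1) (deg-∷-∈ v∈ₑe2)))))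
          (trans (sym (deg-↭ (prep e0 (prep e1 σ)) v)) deg-v)))
        S3 = ih (≤-trans (n≤1+n _) len2′) adm3 (light⇒at-most-one-heavy (light-mono deg3≤ light))
        free-a : ∀ {x d} → deg es3 x ≡ 0 → F x ≡ d ∷ [] → a ≢ d → Free F es3 (colour S3) x a
        free-a iso Fx a≢d = free-isolated iso (∉-single Fx a≢d)
        S2 : ListColouring F es2
        S2 = restrict (∈-resp-↭ σ) (extend S3 (label-fresh adm2′) a (joins-elim (λ x → Free F es3 (colour S3) x a) wt
               (free-a w-isolated Fw (a≢b ∘ (λ a≡c → trans a≡c c≡b)))
               (subst (λ x → Free F es3 (colour S3) x a) (sym t≡v) (free-a v-isolated Fv a≢b))))
        coloured-a : ∀ {x} → deg es3 x ≡ 0 → ∀ {f} → f ∈ e2 ∷ es3 → x ∈ₑ f → colour S2 (label f) ≡ a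
        coloured-a iso (here refl) _ = recolour-new {e = e2} S3 (label-fresh adm2′) a
        coloured-a iso (there f∈) x∈ₑf = ⊥-elim (deg≡0⇒∉ₑ iso f∈ x∈ₑf)
        k = proj₁ (fresh-colour (a ∷ b ∷ []) (s≤s (s≤s z≤n)))
        k∉ = proj₂ (fresh-colour (a ∷ b ∷ []) (s≤s (s≤s z≤n)))
        μ = proj₁ (fresh-colour (k ∷ a ∷ c ∷ []) ≤-refl)
        μ∉ = proj₂ (fresh-colour (k ∷ a ∷ c ∷ []) ≤-refl)

      -- With its end w moved to v, the edge e2 also avoids the colours at v, leaving room for e0 and e1.
      colour-by-rerouting : t ≢ v → ListColouring F (e0 ∷ e1 ∷ es2)
      colour-by-rerouting t≢v = complete-path (k∉ ∘ here) (k∉ ∘ there ∘ here) μ∉′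
        (forbid-unused-at-e0 (restrict (∈-resp-↭ σ) S2) (k-unused ∘ ∈-resp-↭ σ)) (μ-unused ∘ ∈-resp-↭ σ)
        where
        e2′ : Edge
        e2′ = edge (label e2) v t
        v∉ₑe2 : ¬ v ∈ₑ e2
        v∉ₑe2 v∈ₑe2 = joins-elim (λ x → x ≢ v) wt w≢v t≢v v∈ₑe2 refl
        deg′≤ : ∀ x → deg (e2′ ∷ es3) x ≤ deg (e0 ∷ e1 ∷ es2) x
        deg′≤ x with x ≟ v
        ... | yes refl = deg-∷-mono {e0} {e2′} (λ _ → joins-∈ₑʳ uv)
                           (≤-trans (deg-∷-≤ e2 es3 v) (subst (_≤ _) (deg-↭ σ v) (deg-∷-≤ e1 es2 v)))
        ... | no x≢v =
          ≤-trans (deg-∷-mono (λ { (at-src v≡x) → ⊥-elim (x≢v (sym v≡x)) ; (at-tgt refl) → joins-∈ₑʳ wt }) ≤-refl)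
                  (subst (_≤ _) (deg-↭ σ x) (deg≤ x))
        adm′ : Admissible F (e2′ ∷ es3)
        adm′ = record
          { loopless = λ { (here refl) → t≢v ∘ sym ; (there f∈) → loopless adm2′ (there f∈) }
          ; labels-unique = labels-unique adm2′
          ; load = λ x → ≤-trans (+-mono-≤ (deg′≤ x) ≤-refl) (load adm x)
          }
        S′ = ih len2′ adm′ (light⇒at-most-one-heavy (light-mono deg′≤ light))
        S2 : ListColouring F (e2 ∷ es3)
        S2 = reattach-end wt w-isolated Fw≡Fv S′
        j = colour S′ (label e2)
        ys = colours-at (colour S′) es3 v
        ys-short : length ys ≤ 1
        ys-short = subst (_≤ 1) (sym (length-colours-at (colour S′) es3 v))
                     (≤-pred (subst (_≤ 2) (deg-∷-∈ {e = e2′} (at-src refl))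
                                    (subst (deg (e2′ ∷ es3) v ≤_) deg-v (deg′≤ v))))
        j≢b : j ≢ b
        j≢b j≡b = avoids S′ (here refl) (at-src refl) (subst (j ∈_) (sym Fv) (here j≡b))
        j∉ys : j ∉ ys
        j∉ys j∈ with f , f∈ , v∈ₑf , j≡ ← ∈-colours-at⁻ (colour S′) j∈ =
          proper S′ (here refl) (there f∈) (label-fresh adm′ f∈) (at-src refl) v∈ₑf j≡
        chosen = two-colours a b j ys ys-short j≢b j∉ys
        k = proj₁ chosen
        μ = proj₁ (proj₂ chosen)
        k∉ = proj₁ (proj₂ (proj₂ chosen))
        μ∉ = proj₁ (proj₂ (proj₂ (proj₂ chosen)))
        μ≢k = proj₂ (proj₂ (proj₂ (proj₂ chosen)))
        μ∉′ : μ ∉ k ∷ a ∷ c ∷ []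
        μ∉′ (here μ≡k) = μ≢k μ≡k
        μ∉′ (there (here μ≡a)) = μ∉ (here μ≡a)
        μ∉′ (there (there (here μ≡c))) = μ∉ (there (here (trans μ≡c c≡b)))
        k-unused : ∀ {f} → f ∈ e2 ∷ es3 → v ∈ₑ f → colour S′ (label f) ≢ k
        k-unused (here refl) v∈ₑe2 = ⊥-elim (v∉ₑe2 v∈ₑe2)
        k-unused (there f∈) v∈ₑf j≡k = k∉ (there (there (subst (_∈ ys) j≡k (∈-colours-at (colour S′) f∈ v∈ₑf))))
        μ-unused : ∀ {f} → f ∈ e2 ∷ es3 → w ∈ₑ f → colour S′ (label f) ≢ μ
        μ-unused (here refl) _ j≡μ = μ∉ (there (there (here (sym j≡μ))))
        μ-unused (there f∈) w∈ₑf = ⊥-elim (deg≡0⇒∉ₑ w-isolated f∈ w∈ₑf)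

    w-occupied : w ≢ v → 0 < deg es2 w
    w-occupied w≢v = subst (0 <_) (sym (suc-injective (trans (sym (deg-∷-∈ (joins-∈ₑʳ uw)))
                                                             (trans (sym (deg-∷-∉ (w∉ₑe0 w≢v))) deg-w))))
                           (s≤s z≤n)

    colour-via-third-edge : c ≡ b → a ≢ b → w ≢ v → ListColouring F (e0 ∷ e1 ∷ es2)
    colour-via-third-edge c≡b a≢b w≢v
      with e2 , e2∈ , w∈ₑe2 ← deg>0⇒∃ (w-occupied w≢v)
      with es3 , σ ← pick e2∈
      with t , wt ← joins-other-end w∈ₑe2
      with t ≟ v
    ... | yes t≡v = ThirdEdge.colour-triangle c≡b a≢b w≢v σ wt t≡v
    ... | no t≢v = ThirdEdge.colour-by-rerouting c≡b a≢b w≢v σ wt t≢v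

    colour-path : ListColouring F (e0 ∷ e1 ∷ es2)
    colour-path with c ≟ a | c ≟ b
    ... | yes c≡a | _ = let k , k∉ = fresh-colour (a ∷ b ∷ []) (s≤s (s≤s z≤n)) in
      colour-via-forbidding (k∉ ∘ here) (k∉ ∘ there ∘ here) (inj₁ c≡a)
    ... | no c≢a | no c≢b = colour-via-forbidding c≢a c≢b (inj₂ refl)
    ... | no c≢a | yes c≡b with w ≟ v
    ...   | yes w≡v = colour-digon w≡v
    ...   | no w≢v = colour-via-third-edge c≡b (λ a≡b → c≢a (trans c≡b (sym a≡b))) w≢v

  search-ends : ∀ {P : Fin n → Set} → Decidable P → ∀ es →
                (∃ λ e → e ∈ es × ∃ λ x → x ∈ₑ e × P x) ⊎ (∀ {e} → e ∈ es → ∀ {x} → x ∈ₑ e → ¬ P x)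
  search-ends P? [] = inj₂ λ ()
  search-ends P? (e ∷ es) with P? (src e) | P? (tgt e) | search-ends P? es
  ... | yes p | _ | _ = inj₁ (e , here refl , src e , at-src refl , p)
  ... | no _ | yes q | _ = inj₁ (e , here refl , tgt e , at-tgt refl , q)
  ... | no _ | no _ | inj₁ (f , f∈ , found) = inj₁ (f , there f∈ , found)
  ... | no ¬p | no ¬q | inj₂ none =
    inj₂ λ { (here refl) (at-src refl) → ¬p ; (here refl) (at-tgt refl) → ¬q ; (there f∈) → none f∈ }

  colour-tight : ∀ {N} → ColourableUpTo N → ∀ {F e0 es1} → length es1 ≤ N →
                 Admissible F (e0 ∷ es1) → AllLight F (e0 ∷ es1) →
                 (∀ {e} → e ∈ e0 ∷ es1 → ∀ {x} → x ∈ₑ e → 2 < deg (e0 ∷ es1) x + length (F x)) →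
                 (∀ {e} → e ∈ e0 ∷ es1 → ∀ {x} → x ∈ₑ e → F x ≢ []) →
                 ListColouring F (e0 ∷ es1)
  colour-tight ih {F} {e0} {es1} len adm light tight nonempty =
    let e1 , e1∈ , u∈ₑe1 = deg>0⇒∃ u-occupied in colour-along (proj₂ (pick e1∈)) e1∈ (proj₂ (joins-other-end u∈ₑe1))
    where
    single-colour : ∀ {e} → e ∈ e0 ∷ es1 → ∀ {x} → x ∈ₑ e → ∃ λ d → F x ≡ d ∷ []
    single-colour e∈ {x} x∈ₑe = singleton (F x) (light-at light x (deg>0 e∈ x∈ₑe)) (nonempty e∈ x∈ₑe)
      where
      singleton : ∀ (L : List Colour) → length L ≤ 1 → L ≢ [] → ∃ λ d → L ≡ d ∷ []
      singleton [] _ L≢[] = ⊥-elim (L≢[] refl)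
      singleton (d ∷ []) _ _ = d , refl
      singleton (_ ∷ _ ∷ _) (s≤s ()) _
    degree-two : ∀ {e} → e ∈ e0 ∷ es1 → ∀ {x} → x ∈ₑ e → deg (e0 ∷ es1) x ≡ 2
    degree-two e∈ {x} x∈ₑe with d , Fx ← single-colour e∈ x∈ₑe =
      exactly-two (subst (λ L → deg (e0 ∷ es1) x + length L ≤ 3) Fx (load adm x))
                  (subst (λ L → 2 < deg (e0 ∷ es1) x + length L) Fx (tight e∈ x∈ₑe))
      where
      exactly-two : ∀ {d} → d + 1 ≤ 3 → 2 < d + 1 → d ≡ 2
      exactly-two {0} _ (s≤s ())
      exactly-two {1} _ (s≤s (s≤s ()))
      exactly-two {2} _ _ = refl
      exactly-two {suc (suc (suc d))} le _ with () ← m+n≤o⇒n≤o d (≤-pred (≤-pred (≤-pred le)))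
    u-occupied : 0 < deg es1 (src e0)
    u-occupied = subst (0 <_) (sym (suc-injective (trans (sym (deg-∷-∈ {e = e0} {es1} (at-src refl)))
                                                         (degree-two (here refl) (at-src refl)))))
                       (s≤s z≤n)
    colour-along : ∀ {e1 es2 w} → es1 ↭ e1 ∷ es2 → e1 ∈ es1 → Joins e1 (src e0) w → ListColouring F (e0 ∷ es1)
    colour-along {e1} {es2} σ1 e1∈ uw = restrict (∈-resp-↭ σ)
      (TightPath.colour-path ih (≤-trans (n≤1+n _) (subst (_≤ _) (↭-length σ1) len)) (admissible-↭ σ adm)
        (light-mono (λ x → ≤-reflexive (sym (deg-↭ σ x))) light) (joins-src-tgt e0) uw
        (proj₂ (single-colour (here refl) (at-src refl))) (proj₂ (single-colour (here refl) (at-tgt refl)))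
        (proj₂ (single-colour (there e1∈) (joins-∈ₑʳ uw)))
        (degree-two′ (here refl) (at-src refl)) (degree-two′ (here refl) (at-tgt refl))
        (degree-two′ (there e1∈) (joins-∈ₑʳ uw)))
      where
      σ : e0 ∷ es1 ↭ e0 ∷ e1 ∷ es2
      σ = prep e0 σ1
      degree-two′ : ∀ {e} → e ∈ e0 ∷ es1 → ∀ {x} → x ∈ₑ e → deg (e0 ∷ e1 ∷ es2) x ≡ 2
      degree-two′ e∈ {x} x∈ₑe = trans (sym (deg-↭ σ x)) (degree-two e∈ x∈ₑe)

  via-front : ∀ {N F E e} → length E ≤ suc N → e ∈ E → Admissible F E → AtMostOneHeavy F E →
              (∀ {es} → length es ≤ N → Admissible F (e ∷ es) → AtMostOneHeavy F (e ∷ es) →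
                        (∀ x → deg E x ≡ deg (e ∷ es) x) → ListColouring F (e ∷ es)) →
              ListColouring F E
  via-front len e∈ adm one colour-front =
    let es , σ = pick e∈ in
    restrict (∈-resp-↭ σ) (colour-front (≤-pred (subst (_≤ _) (↭-length σ) len)) (admissible-↭ σ adm)
                                        (λ hx hy → one (heavy-along σ hx) (heavy-along σ hy)) (deg-↭ σ))
    where
    heavy-along : ∀ {F es es′ x} → es ↭ es′ → Heavy F es′ x → Heavy F es x
    heavy-along {x = x} σ (heavy d>0 f>1) = heavy (subst (0 <_) (sym (deg-↭ σ x)) d>0) f>1

  list-colouring : ∀ N → ColourableUpTo N
  list-colouring _ {es = []} _ _ _ = empty-colouring
  list-colouring (suc N) {F} {E@(e ∷ es)} len adm one with heavy-or-light F E
  ... | inj₁ (p , hp) =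
    let e′ , e′∈ , p∈ₑe′ = deg>0⇒∃ (Heavy.occupied hp) in
    via-front len e′∈ adm one λ len′ adm′ one′ deg≡ →
      colour-heavy-end (list-colouring N) len′ adm′ one′ p∈ₑe′
        (heavy (subst (0 <_) (deg≡ p) (Heavy.occupied hp)) (Heavy.overloaded hp))
  ... | inj₂ light with search-ends (λ x → deg E x + length (F x) ≤? 2) E
  ...   | inj₁ (e′ , e′∈ , u , u∈ₑe′ , slack) =
    via-front len e′∈ adm one λ len′ adm′ one′ deg≡ →
      colour-slack-end (list-colouring N) len′ adm′ one′ u∈ₑe′ (subst (λ d → d + length (F u) ≤ 2) (deg≡ u) slack)
  ...   | inj₂ no-slack with search-ends (λ x → ≡-dec _≟_ (F x) []) E
  ...     | inj₁ (e′ , e′∈ , u , u∈ₑe′ , Fu≡[]) =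
    via-front len e′∈ adm one λ len′ adm′ _ deg≡ →
      colour-unforbidden-end (list-colouring N) len′ adm′ (light-mono (λ x → ≤-reflexive (sym (deg≡ x))) light)
        u∈ₑe′ Fu≡[]
  ...     | inj₂ nonempty =
    colour-tight (list-colouring N) (≤-pred len) adm light (λ e∈ x∈ₑe → ≰⇒> (no-slack e∈ x∈ₑe)) nonempty

-- Precoloured matchings

module FromMultigraph {n m} (G : Multigraph n m) (Δ≤3 : MaxDegreeAtMost G 3)
                      (M : Fin m → Bool) (matching : IsMatching G (λ e → M e ≡ true)) (p : Fin m → Fin 4) where

  open EdgeListColouring n m

  toEdge : Fin m → Edge
  toEdge i = edge i (proj₁ (ends G i)) (proj₂ (ends G i))

  incident⇒∈ₑ : ∀ {i x} → Incident G i x → x ∈ₑ toEdge i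
  incident⇒∈ₑ = [ at-src , at-tgt ]′

  ∈ₑ⇒incident : ∀ {i x} → x ∈ₑ toEdge i → Incident G i x
  ∈ₑ⇒incident (at-src s) = inj₁ s
  ∈ₑ⇒incident (at-tgt t) = inj₂ t

  unmatched? : Decidable (λ i → M i ≡ false)
  unmatched? i = M i ≟ᵇ false

  matched-at? : ∀ x → Decidable (λ i → M i ≡ true × Incident G i x)
  matched-at? x i = (M i ≟ᵇ true) ×-dec incident? G x i

  uncoloured : List Edge
  uncoloured = map toEdge (filter unmatched? (allFin m))

  precoloured : Forbidden
  precoloured x = map p (filter (matched-at? x) (allFin m))

  ∈-uncoloured : ∀ {i} → M i ≡ false → toEdge i ∈ uncoloured
  ∈-uncoloured {i} Mi = ∈-map⁺ toEdge (∈-filter⁺ unmatched? (∈-allFin i) Mi)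

  ∈-precoloured : ∀ {i x} → M i ≡ true → Incident G i x → p i ∈ precoloured x
  ∈-precoloured {i} {x} Mi inc = ∈-map⁺ p (∈-filter⁺ (matched-at? x) (∈-allFin i) (Mi , inc))

  load-split : ∀ x L → deg (map toEdge (filter unmatched? L)) x + count (matched-at? x) L ≡ count (incident? G x) L
  load-split x [] = refl
  load-split x (i ∷ L) = by-cases (M i) refl (incident? G x i)
    where
    deg-of = λ L′ → deg (map toEdge L′) x
    by-cases : ∀ b → M i ≡ b → Dec (Incident G i x) →
               deg-of (filter unmatched? (i ∷ L)) + count (matched-at? x) (i ∷ L) ≡ count (incident? G x) (i ∷ L)
    by-cases true Mi (yes inc) =
      trans (cong₂ _+_ (cong deg-of (filter-reject unmatched? (not-¬ Mi))) (count-accept (matched-at? x) (Mi , inc)))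
            (trans (+-suc _ _) (trans (cong suc (load-split x L)) (sym (count-accept (incident? G x) inc))))
    by-cases true Mi (no ¬inc) =
      trans (cong₂ _+_ (cong deg-of (filter-reject unmatched? (not-¬ Mi))) (count-reject (matched-at? x) (¬inc ∘ proj₂)))
            (trans (load-split x L) (sym (count-reject (incident? G x) ¬inc)))
    by-cases false Mi (yes inc) =
      trans (cong₂ _+_ (trans (cong deg-of (filter-accept unmatched? Mi)) (deg-∷-∈ (incident⇒∈ₑ inc)))
                       (count-reject (matched-at? x) (not-¬ Mi ∘ proj₁)))
            (trans (cong suc (load-split x L)) (sym (count-accept (incident? G x) inc)))
    by-cases false Mi (no ¬inc) =
      trans (cong₂ _+_ (trans (cong deg-of (filter-accept unmatched? Mi)) (deg-∷-∉ (¬inc ∘ ∈ₑ⇒incident)))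
                       (count-reject (matched-at? x) (¬inc ∘ proj₂)))
            (trans (load-split x L) (sym (count-reject (incident? G x) ¬inc)))

  admissible : Admissible precoloured uncoloured
  admissible = record
    { loopless = λ e∈ → let i , _ , e≡ = ∈-map⁻ toEdge e∈ in subst (λ e → src e ≢ tgt e) (sym e≡) (noLoop G i)
    ; labels-unique = subst Unique (map-∘ (filter unmatched? (allFin m)))
                        (subst Unique (sym (map-id (filter unmatched? (allFin m)))) (Unique.filter⁺ unmatched? (Unique.allFin⁺ m)))
    ; load = λ x → subst (_≤ 3) (sym (trans (cong (deg uncoloured x +_) (length-map p (filter (matched-at? x) (allFin m))))
                                            (load-split x (allFin m))))
                         (Δ≤3 x)
    }

  light : AllLight precoloured uncoloured
  light = all-light λ x _ →
    subst (_≤ 1) (sym (length-map p (filter (matched-at? x) (allFin m))))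
          (count-unique (matched-at? x) (Unique.allFin⁺ m) (at-most-one x))
    where
    at-most-one : ∀ x {i j} → i ∈ allFin m → j ∈ allFin m →
                  M i ≡ true × Incident G i x → M j ≡ true × Incident G j x → i ≡ j
    at-most-one x {i} {j} _ _ (Mi , inc-i) (Mj , inc-j) with i ≟ j
    ... | yes i≡j = i≡j
    ... | no i≢j = ⊥-elim (matching i j Mi Mj (i≢j , x , inc-i , inc-j))

  colouring : ListColouring precoloured uncoloured
  colouring = list-colouring (length uncoloured) ≤-refl admissible (light⇒at-most-one-heavy light)

  extension : Fin m → Fin 4
  extension i = if M i then p i else colour colouring i

  extension-agrees : ∀ i → M i ≡ true → extension i ≡ p i
  extension-agrees i Mi rewrite Mi = refl

  extension-proper : IsProperEdgeColouring G extension
  extension-proper i j (i≢j , x , inc-i , inc-j) with M i in Mi | M j in Mj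
  ... | true | true = ⊥-elim (matching i j Mi Mj (i≢j , x , inc-i , inc-j))
  ... | true | false = λ pi≡ →
    avoids colouring (∈-uncoloured Mj) (incident⇒∈ₑ inc-j) (subst (_∈ _) pi≡ (∈-precoloured Mi inc-i))
  ... | false | true = λ ≡pj →
    avoids colouring (∈-uncoloured Mi) (incident⇒∈ₑ inc-i) (subst (_∈ _) (sym ≡pj) (∈-precoloured Mj inc-j))
  ... | false | false = proper colouring (∈-uncoloured Mi) (∈-uncoloured Mj) i≢j (incident⇒∈ₑ inc-i) (incident⇒∈ₑ inc-j)

theorem1p7 : ∀ {n m} (G : Multigraph n m) → MaxDegreeAtMost G 3 →
    (M : Fin m → Bool) → IsMatching G (λ e → M e ≡ true) →
    (p : Fin m → Fin 4) →
    Σ (Fin m → Fin 4) (λ c → IsProperEdgeColouring G c × (∀ e → M e ≡ true → c e ≡ p e))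
theorem1p7 G Δ≤3 M matching p = extension , extension-proper , extension-agrees
  where open FromMultigraph G Δ≤3 M matching p
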